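{- There is an algorithm which, given an instance $G=(A\cup B,E)$ of the strongly stable matching problem that admits at least one strongly stable matching, computes a maximal sequence of strongly stable matchings of $G$.
   Context: An instance of the strongly stable matching problem is a finite bipartite graph $G=(A\cup B,E)$ (vertices of $A$ are "men", of $B$ "women") in which every vertex $v$ has a preference list: its neighbours are partitioned into disjoint ties (possibly singletons) which are linearly ordered. For neighbours $x,y$ of $v$ write $x\succ_v y$ if $x$ lies in a strictly earlier tie than $y$, $x=_v y$ if in the same tie, $x\succeq_v y$ if either. A matching is a set of pairwise vertex-disjoint edges; $M(v)$ is the partner of $v$. An edge $e\in E\setminus M$ blocks $M$ if its endpoints can be labelled $x,y$ with ($x$ unmatched or $y\succ_x M(x)$) and ($y$ unmatched or $x\succeq_y M(y)$); $M$ is strongly stable if no edge blocks it. All strongly stable matchings match the same vertices. For strongly stable $M,N$: $M\succeq N$ if $M(m)\succeq_m N(m)$ for every matched man $m$, and $M\succ N$ if moreover some man $m$ has $M(m)\succ_m N(m)$. A man-optimal strongly stable matching is one in which every man gets a partner at least as good (w.r.t. his preferences) as in any strongly stable matching; woman-optimal is defined symmetrically for women. A maximal sequence of strongly stable matchings is a sequence $M_0\succ M_1\succ\dots\succ M_z$ of strongly stable matchings such that $M_0$ is man-optimal, $M_z$ is woman-optimal, and for each $1\le i\le z$ there is no strongly stable matching $M'$ with $M_{i-1}\succ M'\succ M_i$. -}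

module Defs where

open import Data.Nat using (ℕ; zero; suc; _≤_; _<_)
open import Data.Fin using (Fin; fromℕ; inject₁)
open import Data.Bool using (Bool; true)
open import Data.Maybe using (Maybe; just; nothing)
open import Data.Product using (Σ; Σ-syntax; ∃; _×_; _,_)
open import Data.Sum using (_⊎_)
open import Relation.Binary.PropositionalEquality using (_≡_; _≢_)
open import Relation.Nullary using (¬_)

-- An instance with men A = Fin m and women B = Fin n.
-- edge a b : whether {a,b} ∈ E.
-- Preference lists with ties are encoded by ranks: for a neighbour b of a,
-- rankM a b is the index of the tie containing b in a's list (smaller = better);
-- two neighbours are in the same tie iff they have the same rank.
-- Ranks of non-neighbours are irrelevant.
record Instance (m n : ℕ) : Set where
  field
    edge  : Fin m → Fin n → Bool
    rankM : Fin m → Fin n → ℕ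
    rankW : Fin n → Fin m → ℕ
open Instance public

Matching : ℕ → ℕ → Set
Matching m n = Fin m → Maybe (Fin n)

module _ {m n : ℕ} (I : Instance m n) where

  IsMatching : Matching m n → Set
  IsMatching μ =
    (∀ a b → μ a ≡ just b → edge I a b ≡ true) ×
    (∀ a a' b → μ a ≡ just b → μ a' ≡ just b → a ≡ a')

  ManStrict : Matching m n → Fin m → Fin n → Set
  ManStrict μ a b = (μ a ≡ nothing) ⊎ (Σ[ b' ∈ Fin n ] (μ a ≡ just b' × rankM I a b < rankM I a b'))

  ManWeak : Matching m n → Fin m → Fin n → Set
  ManWeak μ a b = (μ a ≡ nothing) ⊎ (Σ[ b' ∈ Fin n ] (μ a ≡ just b' × rankM I a b ≤ rankM I a b'))

  WomanUnmatched : Matching m n → Fin n → Set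
  WomanUnmatched μ b = ∀ a' → μ a' ≢ just b

  WomanStrict : Matching m n → Fin n → Fin m → Set
  WomanStrict μ b a = WomanUnmatched μ b ⊎ (Σ[ a' ∈ Fin m ] (μ a' ≡ just b × rankW I b a < rankW I b a'))

  WomanWeak : Matching m n → Fin n → Fin m → Set
  WomanWeak μ b a = WomanUnmatched μ b ⊎ (Σ[ a' ∈ Fin m ] (μ a' ≡ just b × rankW I b a ≤ rankW I b a'))

  -- edge {a,b} ∈ E ∖ M blocks M (either labelling x=a,y=b or x=b,y=a)
  Blocks : Matching m n → Fin m → Fin n → Set
  Blocks μ a b =
    edge I a b ≡ true × μ a ≢ just b ×
    ((ManStrict μ a b × WomanWeak μ b a) ⊎ (WomanStrict μ b a × ManWeak μ a b))

  StronglyStable : Matching m n → Set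
  StronglyStable μ = IsMatching μ × (∀ a b → ¬ Blocks μ a b)

  _⪰_ : Matching m n → Matching m n → Set
  M ⪰ N = ∀ a b b' → M a ≡ just b → N a ≡ just b' → rankM I a b ≤ rankM I a b'

  _≻_ : Matching m n → Matching m n → Set
  M ≻ N = M ⪰ N ×
    (Σ[ a ∈ Fin m ] Σ[ b ∈ Fin n ] Σ[ b' ∈ Fin n ]
      (M a ≡ just b × N a ≡ just b' × rankM I a b < rankM I a b'))

  ManOptimal : Matching m n → Set
  ManOptimal M = StronglyStable M ×
    (∀ N → StronglyStable N →
      ∀ a b b' → M a ≡ just b → N a ≡ just b' → rankM I a b ≤ rankM I a b')

  WomanOptimal : Matching m n → Set
  WomanOptimal M = StronglyStable M ×
    (∀ N → StronglyStable N →
      ∀ b a a' → M a ≡ just b → N a' ≡ just b → rankW I b a ≤ rankW I b a')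

  record MaximalSequence : Set where
    field
      z        : ℕ
      seq      : Fin (suc z) → Matching m n
      allSS    : ∀ i → StronglyStable (seq i)
      first    : ManOptimal (seq Fin.zero)
      last     : WomanOptimal (seq (fromℕ z))
      decr     : ∀ (i : Fin z) → seq (inject₁ i) ≻ seq (Fin.suc i)
      noBetween : ∀ (i : Fin z) (M' : Matching m n) → StronglyStable M' →
                  ¬ (seq (inject₁ i) ≻ M' × M' ≻ seq (Fin.suc i))

module Submission where

-- Let S be the rank sum of a matching (total rank of the men's partners); between strongly
-- stable matchings, M ≻ N forces S M < S N.  Hence an S-minimal strongly stable matching is
-- man-optimal, one with no strongly stable matching below it is woman-optimal, and the
-- S-minimal strongly stable matching below M is an immediate successor of M.  Iterating the
-- last step from the man-optimal matching (S increases and is bounded) gives the sequence.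
-- The optimality facts use the lattice structure: for strongly stable M and N, giving each
-- man the better (J) or worse (K) of his two partners yields strongly stable matchings.  This
-- in turn needs that all strongly stable matchings match the same men and women, proved by a
-- cycle argument resting on an orbit lemma for finite sets.

open import Defs
open import Data.Nat using (ℕ; zero; suc; _+_; _∸_; _≤_; _<_; z≤n; _≤?_; _<?_)
open import Data.Nat.Properties
  using (≤-reflexive; ≤-trans; <-≤-trans; <⇒≤; <-asym; ≮⇒≥; ≰⇒>; <-irrefl; +-suc; m+[n∸m]≡n;
         n<1+n; +-mono-≤; +-mono-<-≤; +-mono-≤-<; m≤m+n; m≤n+m; ∸-monoʳ-<)
open import Data.Nat.Induction using (<-wellFounded)
open import Induction.WellFounded using (Acc; acc)
open import Data.Fin as Fin using (Fin; toℕ; fromℕ; inject₁)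
open import Data.Fin.Properties using (pigeonhole; all?; any?)
open import Data.Bool using (true)
import Data.Bool.Properties as Bool
open import Data.Maybe using (Maybe; just; nothing)
open import Data.Maybe.Properties using (just-injective; ≡-dec)
open import Data.Product using (Σ; Σ-syntax; ∃; ∃₂; ∃-syntax; _×_; _,_; proj₁; proj₂)
open import Data.Sum using (_⊎_; inj₁; inj₂)
open import Data.Empty using (⊥; ⊥-elim)
open import Data.List using (List; []; _∷_; map; filter; allFin; cartesianProductWith)
open import Data.List.Membership.Propositional using (_∈_)
open import Data.List.Membership.Propositional.Properties
  using (∈-map⁺; ∈-allFin; ∈-cartesianProductWith⁺; ∈-filter⁺)
open import Data.List.Relation.Unary.Any using (here; there; satisfied)
import Data.List.Relation.Unary.Any as Any
open import Data.List.Relation.Unary.All using (lookup)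
open import Data.List.Relation.Unary.All.Properties using (all-filter)
open import Data.List.Extrema.Nat using (argmin; argmin-all; f[argmin]≤f[xs])
import Data.Vec.Functional as Vector
open import Relation.Binary.PropositionalEquality using (_≡_; _≢_; _≗_; refl; sym; trans; cong; cong₂; subst; subst₂)
open import Relation.Nullary using (¬_; Dec; yes; no)
open import Relation.Nullary.Decidable using (_×-dec_; _⊎-dec_; ¬?; _→-dec_; map′)
open import Relation.Unary using (Decidable)

-- On a finite set, if every element satisfying P has an R-successor satisfying P
-- and R is injective in its first argument, then every element satisfying P also has an
-- R-predecessor satisfying P: iterating successors must revisit a point, and injectivity lets us
-- walk the repetition back to the start.
module _ {k : ℕ} (P : Fin k → Set) (R : Fin k → Fin k → Set)
         (successor : ∀ x → P x → ∃[ x' ] P x' × R x x')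
         (R-injective : ∀ {x y z} → R x z → R y z → x ≡ y) where

  predecessor : ∀ x₀ → P x₀ → ∃[ y ] P y × R y x₀
  predecessor x₀ p₀ = from-repetition (pigeonhole (n<1+n k) (λ t → point (toℕ t)))
    where
    iterate : ℕ → Σ (Fin k) P
    iterate zero    = x₀ , p₀
    iterate (suc t) = let (x , p) = iterate t in proj₁ (successor x p) , proj₁ (proj₂ (successor x p))

    point : ℕ → Fin k
    point t = proj₁ (iterate t)

    linked : ∀ t → R (point t) (point (suc t))
    linked t = let (x , p) = iterate t in proj₂ (proj₂ (successor x p))

    walk-back : ∀ t d → point t ≡ point (t + suc d) → ∃[ y ] P y × R y x₀
    walk-back zero    d e = point d , proj₂ (iterate d) , subst (R (point d)) (sym e) (linked d)
    walk-back (suc t) d e =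
      walk-back t d (R-injective (linked t) (subst (R (point (t + suc d))) (sym e) (linked (t + suc d))))

    from-repetition : (∃₂ λ i j → i Fin.< j × point (toℕ i) ≡ point (toℕ j)) → ∃[ y ] P y × R y x₀
    from-repetition (i , j , i<j , same) =
      walk-back (toℕ i) (toℕ j ∸ suc (toℕ i))
        (trans same (cong point (sym (trans (+-suc (toℕ i) _) (m+[n∸m]≡n i<j)))))

∑ : ∀ {k} → (Fin k → ℕ) → ℕ
∑ {zero}  f = 0
∑ {suc k} f = f Fin.zero + ∑ (λ i → f (Fin.suc i))

∑-mono : ∀ {k} {f g : Fin k → ℕ} → (∀ i → f i ≤ g i) → ∑ f ≤ ∑ g
∑-mono {zero}  f≤g = z≤n
∑-mono {suc k} f≤g = +-mono-≤ (f≤g Fin.zero) (∑-mono (λ i → f≤g (Fin.suc i)))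

∑-strict : ∀ {k} {f g : Fin k → ℕ} → (∀ i → f i ≤ g i) → ∀ i → f i < g i → ∑ f < ∑ g
∑-strict {suc k} f≤g Fin.zero    fi<gi = +-mono-<-≤ fi<gi (∑-mono (λ i → f≤g (Fin.suc i)))
∑-strict {suc k} f≤g (Fin.suc i) fi<gi = +-mono-≤-< (f≤g Fin.zero) (∑-strict (λ i → f≤g (Fin.suc i)) i fi<gi)

term≤∑ : ∀ {k} (f : Fin k → ℕ) i → f i ≤ ∑ f
term≤∑ f Fin.zero    = m≤m+n _ _
term≤∑ f (Fin.suc i) = ≤-trans (term≤∑ (λ j → f (Fin.suc j)) i) (m≤n+m _ (f Fin.zero))

∑-cong : ∀ {k} {f g : Fin k → ℕ} → f ≗ g → ∑ f ≡ ∑ g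
∑-cong {zero}  f≗g = refl
∑-cong {suc k} f≗g = cong₂ _+_ (f≗g Fin.zero) (∑-cong (λ i → f≗g (Fin.suc i)))

module _ {A : Set} (as : List A) (as-complete : ∀ x → x ∈ as) where

  functions : (k : ℕ) → List (Fin k → A)
  functions zero    = (λ ()) ∷ []
  functions (suc k) = cartesianProductWith Vector._∷_ as (functions k)

  functions-complete : ∀ {k} (f : Fin k → A) → ∃[ g ] g ∈ functions k × g ≗ f
  functions-complete {zero}  f = (λ ()) , here refl , λ ()
  functions-complete {suc k} f =
    let (g , g∈ , g≗) = functions-complete (λ i → f (Fin.suc i)) in
    (f Fin.zero Vector.∷ g) , ∈-cartesianProductWith⁺ Vector._∷_ (as-complete (f Fin.zero)) g∈ ,
    λ { Fin.zero → refl ; (Fin.suc i) → g≗ i }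

module _ {X : Set} (_≈_ : X → X → Set) (xs : List X) (xs-complete : ∀ x → ∃[ y ] y ∈ xs × y ≈ x)
         (f : X → ℕ) (f-resp : ∀ {x y} → x ≈ y → f x ≡ f y) where

  minimise : (Q : X → Set) → Decidable Q → (∀ {x y} → x ≈ y → Q y → Q x) →
             (∀ x → ¬ Q x) ⊎ ∃[ x ] Q x × (∀ y → Q y → f x ≤ f y)
  minimise Q Q? Q-resp with Any.any? Q? xs
  ... | no none = inj₁ λ x q →
    let (y , y∈ , y≈x) = xs-complete x in none (Any.map (λ { refl → Q-resp y≈x q }) y∈)
  ... | yes some = inj₂ (best , argmin-all f (proj₂ (satisfied some)) (all-filter Q? xs) , minimal)
    where
    candidates : List X
    candidates = filter Q? xs

    best : X
    best = argmin f (proj₁ (satisfied some)) candidates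

    minimal : ∀ y → Q y → f best ≤ f y
    minimal y q = let (y' , y'∈ , y'≈y) = xs-complete y in
      subst (f best ≤_) (f-resp y'≈y)
        (lookup (f[argmin]≤f[xs] {f = f} _ candidates) (∈-filter⁺ Q? y'∈ (Q-resp y'≈y q)))

module Stability {m n : ℕ} (I : Instance m n) where

  Match : Set
  Match = Matching m n

  rM : Fin m → Fin n → ℕ
  rM = rankM I

  rW : Fin n → Fin m → ℕ
  rW = rankW I

  SS : Match → Set
  SS = StronglyStable I

  BlockingConditions : Match → Fin m → Fin n → Set
  BlockingConditions μ a b =
    (ManStrict I μ a b × WomanWeak I μ b a) ⊎ (WomanStrict I μ b a × ManWeak I μ a b)

  nothing≢just : ∀ {b : Fin n} → nothing ≢ just b
  nothing≢just ()

  same-partner : ∀ {x : Maybe (Fin n)} {b c} → x ≡ just b → x ≡ just c → b ≡ c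
  same-partner e e' = just-injective (trans (sym e) e')

  rank-at : ∀ {x : Maybe (Fin n)} {a b c} → x ≡ just b → x ≡ just c → rM a b ≡ rM a c
  rank-at e e' = cong (rM _) (same-partner e e')

  injective : ∀ {μ} → IsMatching I μ → ∀ {a a' b} → μ a ≡ just b → μ a' ≡ just b → a ≡ a'
  injective isM = proj₂ isM _ _ _

  couple-edge : ∀ {μ} → SS μ → ∀ {a b} → μ a ≡ just b → edge I a b ≡ true
  couple-edge sμ = proj₁ (proj₁ sμ) _ _

  man-strict⇒not-couple : ∀ μ {a b} → ManStrict I μ a b → μ a ≢ just b
  man-strict⇒not-couple μ (inj₁ e) e' = nothing≢just (trans (sym e) e')
  man-strict⇒not-couple μ (inj₂ (_ , e , lt)) e' with same-partner e e'
  ... | refl = <-irrefl refl lt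

  woman-strict⇒not-couple : ∀ {μ} → IsMatching I μ → ∀ {a b} → WomanStrict I μ b a → μ a ≢ just b
  woman-strict⇒not-couple isM (inj₁ unmatched) e = unmatched _ e
  woman-strict⇒not-couple isM (inj₂ (a' , e' , lt)) e with injective isM e e'
  ... | refl = <-irrefl refl lt

  unblocked : ∀ {μ} → SS μ → ∀ {a b} → edge I a b ≡ true → ¬ BlockingConditions μ a b
  unblocked {μ} (_ , none) ed c@(inj₁ (ms , _)) = none _ _ (ed , man-strict⇒not-couple μ ms , c)
  unblocked (isM , none) ed c@(inj₂ (ws , _)) = none _ _ (ed , woman-strict⇒not-couple isM ws , c)

  woman-status : (μ : Match) (b : Fin n) → WomanUnmatched I μ b ⊎ ∃[ a ] μ a ≡ just b
  woman-status μ b with any? (λ a → ≡-dec Fin._≟_ (μ a) (just b))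
  ... | yes found = inj₂ found
  ... | no  none  = inj₁ (λ a e → none (a , e))

  partner-of : (μ : Match) {b : Fin n} → ¬ WomanUnmatched I μ b → ∃[ a ] μ a ≡ just b
  partner-of μ {b} matched with woman-status μ b
  ... | inj₁ unmatched = ⊥-elim (matched unmatched)
  ... | inj₂ found     = found

  man-weak-from : ∀ (μ : Match) {a b} → (∀ {d} → μ a ≡ just d → rM a b ≤ rM a d) → ManWeak I μ a b
  man-weak-from μ {a} no-better with μ a
  ... | nothing = inj₁ refl
  ... | just d  = inj₂ (d , refl , no-better refl)

  woman-strictly-prefers : ∀ {μ} → SS μ → ∀ {a b} → edge I a b ≡ true → ManStrict I μ a b →
                           ∃[ a' ] μ a' ≡ just b × rW b a' < rW b a
  woman-strictly-prefers {μ} sμ {a} {b} ed ms with woman-status μ b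
  ... | inj₁ unmatched = ⊥-elim (unblocked sμ ed (inj₁ (ms , inj₁ unmatched)))
  ... | inj₂ (a' , e) with rW b a ≤? rW b a'
  ...   | yes ≤ = ⊥-elim (unblocked sμ ed (inj₁ (ms , inj₂ (a' , e , ≤))))
  ...   | no  ≰ = a' , e , ≰⇒> ≰

  woman-weakly-prefers : ∀ {μ} → SS μ → ∀ {a b} → edge I a b ≡ true → ManWeak I μ a b →
                         ∃[ a' ] μ a' ≡ just b × rW b a' ≤ rW b a
  woman-weakly-prefers {μ} sμ {a} {b} ed mw with woman-status μ b
  ... | inj₁ unmatched = ⊥-elim (unblocked sμ ed (inj₂ (inj₁ unmatched , mw)))
  ... | inj₂ (a' , e) with rW b a <? rW b a'
  ...   | yes < = ⊥-elim (unblocked sμ ed (inj₂ (inj₂ (a' , e , <) , mw)))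
  ...   | no  ≮ = a' , e , ≮⇒≥ ≮

  man-strictly-prefers : ∀ {μ} → SS μ → ∀ {a b} → edge I a b ≡ true → WomanStrict I μ b a →
                         ∃[ b' ] μ a ≡ just b' × rM a b' < rM a b
  man-strictly-prefers {μ} sμ {a} {b} ed ws with μ a in e
  ... | nothing = ⊥-elim (unblocked sμ ed (inj₂ (ws , inj₁ e)))
  ... | just b' with rM a b ≤? rM a b'
  ...   | yes ≤ = ⊥-elim (unblocked sμ ed (inj₂ (ws , inj₂ (b' , e , ≤))))
  ...   | no  ≰ = b' , refl , ≰⇒> ≰

  -- Man a does at least as well in ν as in μ (being unmatched counts as worst).
  record ManImproves (ν μ : Match) (a : Fin m) : Set where
    constructor _,_
    field
      unmatched : ν a ≡ nothing → μ a ≡ nothing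
      better    : ∀ {c d} → ν a ≡ just c → μ a ≡ just d → rM a c ≤ rM a d

  record WomanImproves (ν μ : Match) (b : Fin n) : Set where
    constructor _,_
    field
      unmatched : WomanUnmatched I ν b → WomanUnmatched I μ b
      better    : ∀ {x y} → ν x ≡ just b → μ y ≡ just b → rW b x ≤ rW b y

  man-improves-at-equal : ∀ (ν μ : Match) {a} → ν a ≡ μ a → ManImproves ν μ a
  man-improves-at-equal ν μ ν≡μ =
    (λ e → trans (sym ν≡μ) e) , λ e e' → ≤-reflexive (rank-at (trans (sym ν≡μ) e) e')

  woman-improves-by-inclusion : ∀ {ν μ} → IsMatching I μ → ∀ {b} →
    (WomanUnmatched I ν b → WomanUnmatched I μ b) → (∀ {x} → ν x ≡ just b → μ x ≡ just b) →
    WomanImproves ν μ b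
  woman-improves-by-inclusion isM unmatched included =
    unmatched , λ ex ey → ≤-reflexive (cong (rW _) (injective isM (included ex) ey))

  man-strict-transfer : ∀ {ν μ a b} → ManImproves ν μ a → ManStrict I ν a b → ManStrict I μ a b
  man-strict-transfer (unmatched , _) (inj₁ e) = inj₁ (unmatched e)
  man-strict-transfer {μ = μ} {a} (_ , better) (inj₂ (c , e , lt)) with μ a
  ... | nothing = inj₁ refl
  ... | just d  = inj₂ (d , refl , <-≤-trans lt (better e refl))

  man-weak-transfer : ∀ {ν μ a b} → ManImproves ν μ a → ManWeak I ν a b → ManWeak I μ a b
  man-weak-transfer (unmatched , _) (inj₁ e) = inj₁ (unmatched e)
  man-weak-transfer {μ = μ} {a} (_ , better) (inj₂ (c , e , le)) with μ a
  ... | nothing = inj₁ refl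
  ... | just d  = inj₂ (d , refl , ≤-trans le (better e refl))

  woman-strict-transfer : ∀ {ν μ a b} → WomanImproves ν μ b → WomanStrict I ν b a → WomanStrict I μ b a
  woman-strict-transfer (unmatched , _) (inj₁ u) = inj₁ (unmatched u)
  woman-strict-transfer {μ = μ} {b = b} (_ , better) (inj₂ (x , e , lt)) with woman-status μ b
  ... | inj₁ u        = inj₁ u
  ... | inj₂ (y , e') = inj₂ (y , e' , <-≤-trans lt (better e e'))

  woman-weak-transfer : ∀ {ν μ a b} → WomanImproves ν μ b → WomanWeak I ν b a → WomanWeak I μ b a
  woman-weak-transfer (unmatched , _) (inj₁ u) = inj₁ (unmatched u)
  woman-weak-transfer {μ = μ} {b = b} (_ , better) (inj₂ (x , e , le)) with woman-status μ b
  ... | inj₁ u        = inj₁ u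
  ... | inj₂ (y , e') = inj₂ (y , e' , ≤-trans le (better e e'))

  conditions-transfer : ∀ {ν μ a b} → ManImproves ν μ a → WomanImproves ν μ b →
                        BlockingConditions ν a b → BlockingConditions μ a b
  conditions-transfer man woman (inj₁ (ms , ww)) = inj₁ (man-strict-transfer man ms , woman-weak-transfer woman ww)
  conditions-transfer man woman (inj₂ (ws , mw)) = inj₂ (woman-strict-transfer woman ws , man-weak-transfer man mw)

  ss-resp : ∀ {ν μ} → ν ≗ μ → SS μ → SS ν
  ss-resp {ν} {μ} ν≗μ sμ@((edges , inj) , _) =
    (edges' , inj') , λ a b → λ { (ed , _ , c) → unblocked sμ ed (transfer c) }
    where
    edges' : ∀ a b → ν a ≡ just b → edge I a b ≡ true
    edges' a b e = edges a b (trans (sym (ν≗μ a)) e)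
    inj' : ∀ a a' b → ν a ≡ just b → ν a' ≡ just b → a ≡ a'
    inj' a a' b e e' = inj a a' b (trans (sym (ν≗μ a)) e) (trans (sym (ν≗μ a')) e')
    transfer : ∀ {a b} → BlockingConditions ν a b → BlockingConditions μ a b
    transfer {a} = conditions-transfer (man-improves-at-equal ν μ (ν≗μ a))
      (woman-improves-by-inclusion (proj₁ sμ) (λ u a' e → u a' (trans (ν≗μ a') e))
                                              (λ {x} e → trans (sym (ν≗μ x)) e))

  ≻-resp : ∀ {M ν μ} → ν ≗ μ → _≻_ I M μ → _≻_ I M ν
  ≻-resp ν≗μ (M⪰μ , a , b , b' , eM , eμ , lt) =
    (λ a c c' e e' → M⪰μ a c c' e (trans (sym (ν≗μ a)) e')) , a , b , b' , eM , trans (ν≗μ a) eμ , lt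

  module Rivals {M N : Match} (sM : SS M) (sN : SS N) where

    Rival : Fin m → Fin m → Set
    Rival x x' = ∃[ c ] M x ≡ just c × N x' ≡ just c × rW c x' < rW c x

    -- A rival x' of x has a rival himself: as c prefers x', x' strictly prefers his M-partner c'
    -- to c (else x'–c blocks M), and then c' strictly prefers her N-partner to x' (else x'–c'
    -- blocks N).
    rival-has-rival : ∀ {x x'} → Rival x x' → ∃[ x'' ] Rival x' x''
    rival-has-rival {x} (c , eMx , eNx' , c-prefers-x') =
      let (c' , eMx' , c'-better) = man-strictly-prefers sM (couple-edge sN eNx') (inj₂ (x , eMx , c-prefers-x'))
          (x'' , eNx'' , c'-prefers-x'') = woman-strictly-prefers sN (couple-edge sM eMx') (inj₂ (c , eNx' , c'-better))
      in x'' , c' , eMx' , eNx'' , c'-prefers-x''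

    rival-injective : ∀ {x y z} → Rival x z → Rival y z → x ≡ y
    rival-injective (c , eMx , eNz , _) (c' , eMy , eNz' , _) with same-partner eNz eNz'
    ... | refl = injective (proj₁ sM) eMx eMy

    is-rival : ∀ {x} → ∃ (Rival x) → ∃[ y ] Rival y x
    is-rival {x} r =
      let (y , _ , y-x) = predecessor (λ x → ∃ (Rival x)) Rival (λ _ (x' , r) → x' , rival-has-rival r , r)
                            rival-injective x r
      in y , y-x

  -- All strongly stable matchings match the same men: if a is matched only in M, his M-partner
  -- b strictly prefers her N-partner, giving a a rival; yet a, unmatched in N, is nobody's rival.
  men-matched-alike : ∀ {M N} → SS M → SS N → ∀ {a b} → M a ≡ just b → N a ≢ nothing
  men-matched-alike sM sN eM eN =
    let (a₁ , eN₁ , lt) = woman-strictly-prefers sN (couple-edge sM eM) (inj₁ eN)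
        (y , c , _ , eNa , _) = Rivals.is-rival sM sN (a₁ , _ , eM , eN₁ , lt)
    in nothing≢just (trans (sym eN) eNa)

  -- ... and the same women: if b is matched to a in M only, then a strictly prefers his
  -- N-partner, who makes a a rival (in the roles of N and M); the man whose rival a is would be
  -- b's N-partner.
  women-matched-alike : ∀ {M N} → SS M → SS N → ∀ {a b} → M a ≡ just b → ¬ WomanUnmatched I N b
  women-matched-alike {M} {N} sM sN {a} {b} eM unmatched =
    let (b₁ , eN , a-prefers-b₁) = man-strictly-prefers sN (couple-edge sM eM) (inj₁ unmatched)
        (a₁ , eM₁ , b₁-prefers-a₁) = woman-strictly-prefers sM (couple-edge sN eN) (inj₂ (b , eM , a-prefers-b₁))
        (y , c , eNy , eMa , _) = Rivals.is-rival sN sM (a₁ , b₁ , eN , eM₁ , b₁-prefers-a₁)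
    in unmatched y (subst (λ c → N y ≡ just c) (same-partner eMa eM) eNy)

  man-partner : ∀ {M N} → SS M → SS N → ∀ {a b} → N a ≡ just b → ∃[ c ] M a ≡ just c
  man-partner {M} sM sN {a} eN with M a in eM
  ... | nothing = ⊥-elim (men-matched-alike sN sM eN eM)
  ... | just c  = c , refl

  unmatched-alike : ∀ {M N} → SS M → SS N → ∀ {a} → M a ≡ nothing → N a ≡ nothing
  unmatched-alike {N = N} sM sN {a} eM = by-cases (N a) refl
    where
    by-cases : ∀ x → N a ≡ x → N a ≡ nothing
    by-cases nothing  e = e
    by-cases (just d) e = ⊥-elim (men-matched-alike sN sM e eM)

  woman-partner : ∀ {M N} → SS M → SS N → ∀ {a b} → N a ≡ just b → ∃[ a' ] M a' ≡ just b
  woman-partner {M} sM sN eN = partner-of M (women-matched-alike sN sM eN)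

  covers : ∀ {ν μ : Match} → (∀ {x y c} → ν x ≡ just c → ν y ≡ just c → x ≡ y) →
           (∀ {x c} → ν x ≡ just c → ∃[ x' ] μ x' ≡ just c) →
           (∀ {x d} → μ x ≡ just d → ∃[ c ] ν x ≡ just c) →
           ∀ {y b} → μ y ≡ just b → ∃[ w ] ν w ≡ just b
  covers {ν} {μ} ν-injective women men {y} {b} eμy =
    let (w , _ , d , eνw , eμy') = predecessor Matched Next step next-injective y (b , eμy)
    in w , subst (λ d → ν w ≡ just d) (same-partner eμy' eμy) eνw
    where
    Matched : Fin m → Set
    Matched x = ∃[ c ] μ x ≡ just c
    Next : Fin m → Fin m → Set
    Next x x' = ∃[ d ] ν x ≡ just d × μ x' ≡ just d
    step : ∀ x → Matched x → ∃[ x' ] Matched x' × Next x x'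
    step x (_ , eμx) =
      let (d , eνx) = men eμx
          (x' , eμx') = women eνx
      in x' , (d , eμx') , d , eνx , eμx'
    next-injective : ∀ {x y z} → Next x z → Next y z → x ≡ y
    next-injective (d , eνx , eμz) (d' , eνy , eμz') with same-partner eμz eμz'
    ... | refl = ν-injective eνx eνy

  -- The join J and meet K of strongly stable M and N: every man gets the better (in J) or the
  -- worse (in K) of his two partners, ties going to M in J and to N in K.
  module Lattice {M N : Match} (sM : SS M) (sN : SS N) where

    PrefersN : Fin m → Set
    PrefersN a = ∃[ b ] ∃[ b' ] M a ≡ just b × N a ≡ just b' × rM a b' < rM a b

    PrefersM : Fin m → Set
    PrefersM a = ∀ {b b'} → M a ≡ just b → N a ≡ just b' → rM a b ≤ rM a b'

    exclusive : ∀ {a} → PrefersN a → PrefersM a → ⊥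
    exclusive (b , b' , eM , eN , lt) ≥ = <-irrefl refl (<-≤-trans lt (≥ eM eN))

    compare : ∀ a → PrefersN a ⊎ PrefersM a
    compare a with M a | N a
    ... | just b  | just b' with rM a b' <? rM a b
    ...   | yes < = inj₁ (b , b' , refl , refl , <)
    ...   | no  ≮ = inj₂ λ { refl refl → ≮⇒≥ ≮ }
    compare a | just b  | nothing = inj₂ λ _ ()
    compare a | nothing | _       = inj₂ λ ()

    better worse : ∀ a → PrefersN a ⊎ PrefersM a → Maybe (Fin n)
    better a (inj₁ _) = N a
    better a (inj₂ _) = M a
    worse  a (inj₁ _) = M a
    worse  a (inj₂ _) = N a

    J K : Match
    J a = better a (compare a)
    K a = worse a (compare a)

    Split : Fin m → Set
    Split a = (J a ≡ N a × K a ≡ M a × PrefersN a) ⊎ (J a ≡ M a × K a ≡ N a × PrefersM a)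

    split : ∀ a → Split a
    split a = by-cases (compare a)
      where
      by-cases : (v : PrefersN a ⊎ PrefersM a) →
        (better a v ≡ N a × worse a v ≡ M a × PrefersN a) ⊎
        (better a v ≡ M a × worse a v ≡ N a × PrefersM a)
      by-cases (inj₁ p) = inj₁ (refl , refl , p)
      by-cases (inj₂ p) = inj₂ (refl , refl , p)

    J-source : ∀ a → J a ≡ M a ⊎ J a ≡ N a
    J-source a with split a
    ... | inj₁ (j , _) = inj₂ j
    ... | inj₂ (j , _) = inj₁ j

    K-source : ∀ a → K a ≡ M a ⊎ K a ≡ N a
    K-source a with split a
    ... | inj₁ (_ , k , _) = inj₁ k
    ... | inj₂ (_ , k , _) = inj₂ k

    module Mixture (ν : Match) (source : ∀ a → ν a ≡ M a ⊎ ν a ≡ N a)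
                   (ν-injective : ∀ {x y c} → ν x ≡ just c → ν y ≡ just c → x ≡ y) where

      is-matching : IsMatching I ν
      is-matching = edges , λ _ _ _ → ν-injective
        where
        edges : ∀ a b → ν a ≡ just b → edge I a b ≡ true
        edges a b e with source a
        ... | inj₁ νM = couple-edge sM (trans (sym νM) e)
        ... | inj₂ νN = couple-edge sN (trans (sym νN) e)

      women-in-M : ∀ {x c} → ν x ≡ just c → ∃[ x' ] M x' ≡ just c
      women-in-M {x} e with source x
      ... | inj₁ νM = x , trans (sym νM) e
      ... | inj₂ νN = woman-partner sM sN (trans (sym νN) e)

      women-in-N : ∀ {x c} → ν x ≡ just c → ∃[ x' ] N x' ≡ just c
      women-in-N {x} e with source x
      ... | inj₁ νM = woman-partner sN sM (trans (sym νM) e)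
      ... | inj₂ νN = x , trans (sym νN) e

      men-from-M : ∀ {x d} → M x ≡ just d → ∃[ c ] ν x ≡ just c
      men-from-M {x} e with source x
      ... | inj₁ νM = _ , trans νM e
      ... | inj₂ νN = let (c , eN) = man-partner sN sM e in c , trans νN eN

      men-from-N : ∀ {x d} → N x ≡ just d → ∃[ c ] ν x ≡ just c
      men-from-N {x} e with source x
      ... | inj₁ νM = let (c , eM) = man-partner sM sN e in c , trans νM eM
      ... | inj₂ νN = _ , trans νN e

      covers-M : ∀ {y b} → M y ≡ just b → ∃[ w ] ν w ≡ just b
      covers-M = covers ν-injective women-in-M men-from-M

      covers-N : ∀ {y b} → N y ≡ just b → ∃[ w ] ν w ≡ just b
      covers-N = covers ν-injective women-in-N men-from-N

    -- J is injective: if b were J-partner of x via M (x weakly prefers M) and of y via N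
    -- (y strictly prefers N), then b strictly prefers x to y (else y–b blocks M), and x–b
    -- would block N.
    J-mixed : ∀ {x y b} → PrefersM x → M x ≡ just b → PrefersN y → N y ≡ just b → ⊥
    J-mixed {x} {y} {b} x≥ eMx (c , b' , eMy , eNy' , lt) eNy with same-partner eNy' eNy
    ... | refl =
      let (x' , eMx' , b-prefers-x') = woman-strictly-prefers sM (couple-edge sN eNy) (inj₂ (c , eMy , lt))
          b-prefers-x = subst (λ z → rW b z < rW b y) (injective (proj₁ sM) eMx' eMx) b-prefers-x'
      in unblocked sN (couple-edge sM eMx) (inj₂ (inj₂ (y , eNy , b-prefers-x) , man-weak-from N (x≥ eMx)))

    J-injective : ∀ {x y b} → J x ≡ just b → J y ≡ just b → x ≡ y
    J-injective {x} {y} ex ey with split x | split y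
    ... | inj₁ (jx , _) | inj₁ (jy , _) = injective (proj₁ sN) (trans (sym jx) ex) (trans (sym jy) ey)
    ... | inj₂ (jx , _) | inj₂ (jy , _) = injective (proj₁ sM) (trans (sym jx) ex) (trans (sym jy) ey)
    ... | inj₂ (jx , _ , x≥) | inj₁ (jy , _ , y<) = ⊥-elim (J-mixed x≥ (trans (sym jx) ex) y< (trans (sym jy) ey))
    ... | inj₁ (jx , _ , x<) | inj₂ (jy , _ , y≥) = ⊥-elim (J-mixed y≥ (trans (sym jy) ey) x< (trans (sym jx) ex))

    module JM = Mixture J J-source J-injective

    -- K is injective: if b were K-partner of x via N (x weakly prefers M) and of y via M
    -- (y strictly prefers N), her J-partner would be x or y, contradicting their preferences.
    K-mixed : ∀ {x y b} → PrefersM x → N x ≡ just b → PrefersN y → M y ≡ just b → ⊥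
    K-mixed x≥ eNx y< eMy with JM.covers-M eMy
    ... | w , eJw with split w
    ...   | inj₁ (jw , _ , w<) with injective (proj₁ sN) (trans (sym jw) eJw) eNx
    ...     | refl = exclusive w< x≥
    K-mixed x≥ eNx y< eMy | w , eJw | inj₂ (jw , _ , w≥) with injective (proj₁ sM) (trans (sym jw) eJw) eMy
    ...     | refl = exclusive y< w≥

    K-injective : ∀ {x y b} → K x ≡ just b → K y ≡ just b → x ≡ y
    K-injective {x} {y} ex ey with split x | split y
    ... | inj₁ (_ , kx , _) | inj₁ (_ , ky , _) = injective (proj₁ sM) (trans (sym kx) ex) (trans (sym ky) ey)
    ... | inj₂ (_ , kx , _) | inj₂ (_ , ky , _) = injective (proj₁ sN) (trans (sym kx) ex) (trans (sym ky) ey)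
    ... | inj₂ (_ , kx , x≥) | inj₁ (_ , ky , y<) = ⊥-elim (K-mixed x≥ (trans (sym kx) ex) y< (trans (sym ky) ey))
    ... | inj₁ (_ , kx , x<) | inj₂ (_ , ky , y≥) = ⊥-elim (K-mixed y≥ (trans (sym ky) ey) x< (trans (sym kx) ex))

    module KM = Mixture K K-source K-injective

    J-improves-M : ∀ a → ManImproves J M a
    J-improves-M a with split a
    ... | inj₁ (j , _ , (b , b' , eM , eN , lt)) =
          (λ e → ⊥-elim (nothing≢just (trans (sym e) (trans j eN)))) ,
          (λ eJ eM' → <⇒≤ (subst₂ _<_ (rank-at eN (trans (sym j) eJ)) (rank-at eM eM') lt))
    ... | inj₂ (j , _) = man-improves-at-equal J M j

    J-improves-N : ∀ a → ManImproves J N a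
    J-improves-N a with split a
    ... | inj₁ (j , _) = man-improves-at-equal J N j
    ... | inj₂ (j , _ , a≥) =
          (λ e → unmatched-alike sM sN (trans (sym j) e)) , λ eJ eN → a≥ (trans (sym j) eJ) eN

    K-no-better-than-M : ∀ {a c d} → M a ≡ just c → K a ≡ just d → rM a c ≤ rM a d
    K-no-better-than-M {a} eM eK with split a
    ... | inj₁ (_ , k , _)  = ≤-reflexive (rank-at eM (trans (sym k) eK))
    ... | inj₂ (_ , k , a≥) = a≥ eM (trans (sym k) eK)

    J-takes-N : ∀ {a b b'} → M a ≡ just b → N a ≡ just b' → rM a b' < rM a b → J a ≡ just b'
    J-takes-N {a} eM eN lt with split a
    ... | inj₁ (j , _)      = trans j eN
    ... | inj₂ (_ , _ , a≥) = ⊥-elim (<-irrefl refl (<-≤-trans lt (a≥ eM eN)))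

    K-takes-N : ∀ {a b b'} → M a ≡ just b → N a ≡ just b' → rM a b < rM a b' → K a ≡ just b'
    K-takes-N {a} eM eN lt with split a
    ... | inj₁ (_ , _ , (c , c' , eM' , eN' , c'<c)) =
          ⊥-elim (<-asym lt (subst₂ _<_ (rank-at eN' eN) (rank-at eM' eM) c'<c))
    ... | inj₂ (_ , k , _)  = trans k eN

    J-woman-source : ∀ b → WomanImproves J M b ⊎ WomanImproves J N b
    J-woman-source b with woman-status J b
    ... | inj₁ unmatched = inj₁ (woman-improves-by-inclusion (proj₁ sM)
            (λ _ y eMy → let (w , eJw) = JM.covers-M eMy in unmatched w eJw)
            (λ eJx → ⊥-elim (unmatched _ eJx)))
    ... | inj₂ (w , eJw) with J-source w
    ...   | inj₁ jw = inj₁ (woman-improves-by-inclusion (proj₁ sM) (λ u → ⊥-elim (u w eJw))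
                        (λ eJx → subst (λ x → M x ≡ just b) (J-injective eJw eJx) (trans (sym jw) eJw)))
    ...   | inj₂ jw = inj₂ (woman-improves-by-inclusion (proj₁ sN) (λ u → ⊥-elim (u w eJw))
                        (λ eJx → subst (λ x → N x ≡ just b) (J-injective eJw eJx) (trans (sym jw) eJw)))

    K-better-than-M : ∀ {x y b} → K x ≡ just b → M y ≡ just b → rW b x ≤ rW b y
    K-better-than-M {x} {y} {b} eKx eMy with split x
    ... | inj₁ (_ , kx , _) = ≤-reflexive (cong (rW b) (injective (proj₁ sM) (trans (sym kx) eKx) eMy))
    ... | inj₂ (_ , kx , _) with split y
    ...   | inj₁ (_ , ky , _) = ≤-reflexive (cong (rW b) (K-injective eKx (trans ky eMy)))
    ...   | inj₂ (_ , _ , y≥) =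
      let (x' , eNx' , le) = woman-weakly-prefers sN (couple-edge sM eMy) (man-weak-from N (y≥ eMy))
      in subst (λ z → rW b z ≤ rW b y) (injective (proj₁ sN) eNx' (trans (sym kx) eKx)) le

    K-better-than-N : ∀ {x y b} → K x ≡ just b → N y ≡ just b → rW b x ≤ rW b y
    K-better-than-N {x} {y} {b} eKx eNy with split x
    ... | inj₂ (_ , kx , _) = ≤-reflexive (cong (rW b) (injective (proj₁ sN) (trans (sym kx) eKx) eNy))
    ... | inj₁ (_ , kx , _) with split y
    ...   | inj₂ (_ , ky , _) = ≤-reflexive (cong (rW b) (K-injective eKx (trans ky eNy)))
    ...   | inj₁ (_ , _ , (c , b' , eMy , eNy' , lt)) =
      let y-prefers-b = subst (λ z → rM y z < rM y c) (same-partner eNy' eNy) lt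
          (x' , eMx' , lt') = woman-strictly-prefers sM (couple-edge sN eNy) (inj₂ (c , eMy , y-prefers-b))
      in <⇒≤ (subst (λ z → rW b z < rW b y) (injective (proj₁ sM) eMx' (trans (sym kx) eKx)) lt')

    K-woman-M : ∀ b → WomanImproves K M b
    K-woman-M b =
      (λ unmatched y eMy → let (w , eKw) = KM.covers-M eMy in unmatched w eKw) , K-better-than-M

    K-woman-N : ∀ b → WomanImproves K N b
    K-woman-N b =
      (λ unmatched y eNy → let (w , eKw) = KM.covers-N eNy in unmatched w eKw) , K-better-than-N

    -- J is strongly stable: a blocking edge a–b of J would also block M or N, whichever gives
    -- b her J-partner, since a does at least as well in J as in both.
    J-ss : SS J
    J-ss = JM.is-matching , λ a b → λ { (ed , _ , conditions) → blocked a b ed conditions (J-woman-source b) }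
      where
      blocked : ∀ a b → edge I a b ≡ true → BlockingConditions J a b →
                WomanImproves J M b ⊎ WomanImproves J N b → ⊥
      blocked a b ed c (inj₁ wM) = unblocked sM ed (conditions-transfer (J-improves-M a) wM c)
      blocked a b ed c (inj₂ wN) = unblocked sN ed (conditions-transfer (J-improves-N a) wN c)

    -- K is strongly stable: a blocking edge a–b of K would also block M or N, whichever gives
    -- a his K-partner, since b does at least as well in K as in both.
    K-ss : SS K
    K-ss = KM.is-matching , λ a b → λ { (ed , _ , conditions) → blocked a b ed conditions (K-source a) }
      where
      blocked : ∀ a b → edge I a b ≡ true → BlockingConditions K a b → K a ≡ M a ⊎ K a ≡ N a → ⊥
      blocked a b ed c (inj₁ kM) =
        unblocked sM ed (conditions-transfer (man-improves-at-equal K M kM) (K-woman-M b) c)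
      blocked a b ed c (inj₂ kN) =
        unblocked sN ed (conditions-transfer (man-improves-at-equal K N kN) (K-woman-N b) c)

  partner-rank : Fin m → Maybe (Fin n) → ℕ
  partner-rank a nothing  = 0
  partner-rank a (just b) = rM a b

  rank-sum : Match → ℕ
  rank-sum μ = ∑ (λ a → partner-rank a (μ a))

  rank-sum-resp : ∀ {ν μ} → ν ≗ μ → rank-sum ν ≡ rank-sum μ
  rank-sum-resp ν≗μ = ∑-cong (λ a → cong (partner-rank a) (ν≗μ a))

  -- Between strongly stable matchings (which match the same men), M ≻ N implies that M has the
  -- strictly smaller rank sum.
  ≻⇒rank-sum< : ∀ {M N} → SS M → SS N → _≻_ I M N → rank-sum M < rank-sum N
  ≻⇒rank-sum< {M} {N} sM sN (M⪰N , a , b , b' , eMa , eNa , lt) =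
    ∑-strict pointwise a (subst₂ _<_ (cong (partner-rank a) (sym eMa)) (cong (partner-rank a) (sym eNa)) lt)
    where
    pointwise : ∀ a → partner-rank a (M a) ≤ partner-rank a (N a)
    pointwise a with M a in eM | N a in eN
    ... | just c  | just c' = M⪰N a c c' eM eN
    ... | nothing | nothing = z≤n
    ... | just c  | nothing = ⊥-elim (men-matched-alike sM sN eM eN)
    ... | nothing | just c' = ⊥-elim (men-matched-alike sN sM eN eM)

  -- The rank sum is bounded, so the potential below strictly decreases along descents M ≻ N.
  rank-bound : ℕ
  rank-bound = ∑ (λ a → ∑ (rM a))

  rank-sum≤bound : ∀ μ → rank-sum μ ≤ rank-bound
  rank-sum≤bound μ = ∑-mono (λ a → partner-rank≤ a (μ a))
    where
    partner-rank≤ : ∀ a x → partner-rank a x ≤ ∑ (rM a)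
    partner-rank≤ a nothing  = z≤n
    partner-rank≤ a (just b) = term≤∑ (rM a) b

  potential : Match → ℕ
  potential μ = rank-bound ∸ rank-sum μ

  potential-decreases : ∀ {M N} → SS M → SS N → _≻_ I M N → potential N < potential M
  potential-decreases {N = N} sM sN M≻N = ∸-monoʳ-< (≻⇒rank-sum< sM sN M≻N) (rank-sum≤bound N)

  _≟_ : (x y : Maybe (Fin n)) → Dec (x ≡ y)
  _≟_ = ≡-dec Fin._≟_

  partner-dec : (x : Maybe (Fin n)) {P : Fin n → Set} → Decidable P → Dec (∀ b → x ≡ just b → P b)
  partner-dec nothing  P? = yes λ _ ()
  partner-dec (just c) {P} P? with P? c
  ... | yes p = yes λ b e → subst P (just-injective e) p
  ... | no ¬p = no λ f → ¬p (f c refl)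

  blocks? : ∀ μ a b → Dec (Blocks I μ a b)
  blocks? μ a b = (edge I a b Bool.≟ true) ×-dec ¬? (μ a ≟ just b) ×-dec
                  ((man-strict? ×-dec woman-weak?) ⊎-dec (woman-strict? ×-dec man-weak?))
    where
    unmatched? : Dec (WomanUnmatched I μ b)
    unmatched? = all? (λ a' → ¬? (μ a' ≟ just b))
    man-strict? : Dec (ManStrict I μ a b)
    man-strict? = (μ a ≟ nothing) ⊎-dec any? (λ b' → (μ a ≟ just b') ×-dec (rM a b <? rM a b'))
    man-weak? : Dec (ManWeak I μ a b)
    man-weak? = (μ a ≟ nothing) ⊎-dec any? (λ b' → (μ a ≟ just b') ×-dec (rM a b ≤? rM a b'))
    woman-strict? : Dec (WomanStrict I μ b a)
    woman-strict? = unmatched? ⊎-dec any? (λ a' → (μ a' ≟ just b) ×-dec (rW b a <? rW b a'))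
    woman-weak? : Dec (WomanWeak I μ b a)
    woman-weak? = unmatched? ⊎-dec any? (λ a' → (μ a' ≟ just b) ×-dec (rW b a ≤? rW b a'))

  ss? : ∀ μ → Dec (SS μ)
  ss? μ = (all? (λ a → partner-dec (μ a) (λ b → edge I a b Bool.≟ true)) ×-dec
           all? (λ a → all? (λ a' →
             partner-dec (μ a) (λ b → (μ a' ≟ just b) →-dec (a Fin.≟ a'))))) ×-dec
          all? (λ a → all? (λ b → ¬? (blocks? μ a b)))

  ≻? : ∀ M N → Dec (_≻_ I M N)
  ≻? M N = map′ (λ f a b b' e e' → f a b e b' e') (λ f a b e b' e' → f a b b' e e')
             (all? (λ a → partner-dec (M a) (λ b → partner-dec (N a) (λ b' → rM a b ≤? rM a b')))) ×-dec
           any? (λ a → any? (λ b → any? (λ b' →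
             (M a ≟ just b) ×-dec (N a ≟ just b') ×-dec (rM a b <? rM a b'))))

  partners : List (Maybe (Fin n))
  partners = nothing ∷ map just (allFin n)

  partners-complete : ∀ x → x ∈ partners
  partners-complete nothing  = here refl
  partners-complete (just b) = there (∈-map⁺ just (∈-allFin b))

  search : (Q : Match → Set) → Decidable Q → (∀ {ν μ} → ν ≗ μ → Q μ → Q ν) →
           (∀ μ → ¬ Q μ) ⊎ ∃[ μ ] Q μ × (∀ ν → Q ν → rank-sum μ ≤ rank-sum ν)
  search = minimise _≗_ (functions partners partners-complete m)
             (functions-complete partners partners-complete) rank-sum rank-sum-resp

  -- A rank-sum-minimal strongly stable matching M is man-optimal: were some man strictly better
  -- off in a strongly stable N, the join of M and N would be strongly stable, ≻ M, and so have
  -- a smaller rank sum.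
  man-optimal : ∀ {M} → SS M → (∀ ν → SS ν → rank-sum M ≤ rank-sum ν) → ManOptimal I M
  man-optimal {M} sM minimal = sM , λ N sN a b b' eM eN → ≮⇒≥ (λ lt → join-below N sN eM eN lt)
    where
    join-below : ∀ N → SS N → ∀ {a b b'} → M a ≡ just b → N a ≡ just b' → rM a b' < rM a b → ⊥
    join-below N sN {a} {b} {b'} eM eN lt =
      <-irrefl refl (<-≤-trans (≻⇒rank-sum< J-ss sM J≻M) (minimal J J-ss))
      where
      open Lattice sM sN
      J≻M : _≻_ I J M
      J≻M = (λ a c d eJ eM' → ManImproves.better (J-improves-M a) eJ eM') ,
            a , b' , b , J-takes-N eM eN lt , eM , lt

  woman-optimal : ∀ {M} → SS M → (∀ ν → SS ν → ¬ _≻_ I M ν) → WomanOptimal I M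
  woman-optimal {M} sM bottom = sM , women
    where
    -- every man does at most as well in M as in a strongly stable N, else M ≻ meet of M and N
    men : ∀ {N} → SS N → ∀ {a c d} → M a ≡ just c → N a ≡ just d → rM a d ≤ rM a c
    men {N} sN {a} {c} {d} eM eN = ≮⇒≥ λ lt →
      bottom K K-ss ((λ a c d eM' eK → K-no-better-than-M eM' eK) ,
                     a , c , d , eM , K-takes-N eM eN lt , lt)
      where open Lattice sM sN

    -- a woman strictly preferring her N-partner a' would, with a', block M
    women : ∀ N → SS N → ∀ b a a' → M a ≡ just b → N a' ≡ just b → rW b a ≤ rW b a'
    women N sN b a a' eM eN = ≮⇒≥ λ lt →
      unblocked sM (couple-edge sN eN)
        (inj₂ (inj₂ (a , eM , lt) , man-weak-from M (λ eMa' → men sN eMa' eN)))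

  record Chain (M : Match) : Set where
    field
      z         : ℕ
      seq       : Fin (suc z) → Match
      starts    : seq Fin.zero ≡ M
      allSS     : ∀ i → SS (seq i)
      last      : WomanOptimal I (seq (fromℕ z))
      decr      : ∀ (i : Fin z) → _≻_ I (seq (inject₁ i)) (seq (Fin.suc i))
      noBetween : ∀ (i : Fin z) (M' : Match) → SS M' →
                  ¬ (_≻_ I (seq (inject₁ i)) M' × _≻_ I M' (seq (Fin.suc i)))

  single : ∀ {M} → SS M → WomanOptimal I M → Chain M
  single {M} sM optimal = record
    { z = 0 ; seq = λ _ → M ; starts = refl ; allSS = λ _ → sM ; last = optimal
    ; decr = λ () ; noBetween = λ () }

  prepend : ∀ {M M'} → SS M → _≻_ I M M' → (∀ M'' → SS M'' → ¬ (_≻_ I M M'' × _≻_ I M'' M')) →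
            Chain M' → Chain M
  prepend {M} {M'} sM M≻M' nothing-between C = record
    { z = suc C.z ; seq = seq ; starts = refl ; allSS = allSS ; last = C.last
    ; decr = decr ; noBetween = noBetween }
    where
    module C = Chain C
    seq : Fin (suc (suc C.z)) → Match
    seq Fin.zero    = M
    seq (Fin.suc i) = C.seq i
    allSS : ∀ i → SS (seq i)
    allSS Fin.zero    = sM
    allSS (Fin.suc i) = C.allSS i
    decr : ∀ (i : Fin (suc C.z)) → _≻_ I (seq (inject₁ i)) (seq (Fin.suc i))
    decr Fin.zero    = subst (_≻_ I M) (sym C.starts) M≻M'
    decr (Fin.suc i) = C.decr i
    noBetween : ∀ (i : Fin (suc C.z)) (M'' : Match) → SS M'' →
                ¬ (_≻_ I (seq (inject₁ i)) M'' × _≻_ I M'' (seq (Fin.suc i)))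
    noBetween Fin.zero    M'' s (M≻M'' , M''≻) =
      nothing-between M'' s (M≻M'' , subst (_≻_ I M'') C.starts M''≻)
    noBetween (Fin.suc i) = C.noBetween i

  -- Every strongly stable M starts a chain: if nothing strongly stable lies below M, M is
  -- woman-optimal; otherwise the rank-sum-minimal strongly stable matching below M is an
  -- immediate successor, and we recurse on it (its potential is smaller).
  chain-from : ∀ M → SS M → Acc _<_ (potential M) → Chain M
  chain-from M sM (acc smaller) with search (λ μ → SS μ × _≻_ I M μ) (λ μ → ss? μ ×-dec ≻? M μ)
                                           (λ ν≗μ (sμ , M≻μ) → ss-resp ν≗μ sμ , ≻-resp ν≗μ M≻μ)
  ... | inj₁ none = single sM (woman-optimal sM (λ ν sν M≻ν → none ν (sν , M≻ν)))
  ... | inj₂ (M' , (sM' , M≻M') , closest) =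
    prepend sM M≻M' nothing-between (chain-from M' sM' (smaller (potential-decreases sM sM' M≻M')))
    where
    nothing-between : ∀ M'' → SS M'' → ¬ (_≻_ I M M'' × _≻_ I M'' M')
    nothing-between M'' sM'' (M≻M'' , M''≻M') =
      <-irrefl refl (<-≤-trans (≻⇒rank-sum< sM'' sM' M''≻M') (closest M'' (sM'' , M≻M'')))

  maximal-sequence : ∀ {M} → ManOptimal I M → Chain M → MaximalSequence I
  maximal-sequence optimal C = record
    { z = z ; seq = seq ; allSS = allSS ; first = subst (ManOptimal I) (sym starts) optimal
    ; last = last ; decr = decr ; noBetween = noBetween }
    where open Chain C

theorem7 : (m n : ℕ) (I : Instance m n) →
    (Σ[ μ ∈ Matching m n ] StronglyStable I μ) → MaximalSequence I
theorem7 m n I (μ , sμ) = from-minimum (search SS ss? ss-resp)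
  where
  open Stability I
  from-minimum : (∀ ν → ¬ SS ν) ⊎ ∃[ M₀ ] SS M₀ × (∀ ν → SS ν → rank-sum M₀ ≤ rank-sum ν) →
                 MaximalSequence I
  from-minimum (inj₁ none) = ⊥-elim (none μ sμ)
  from-minimum (inj₂ (M₀ , s₀ , minimal)) =
    maximal-sequence (man-optimal s₀ minimal) (chain-from M₀ s₀ (<-wellFounded (potential M₀)))
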